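{- For every integer $n\ge 6$ with $n\equiv 2\pmod 4$ there exists a $5$-maxMOFS$(n)$, i.e. a set of $5$ pairwise orthogonal binary frequency squares of order $n$ such that no binary frequency square of order $n$ is orthogonal to all $5$ of them.
   Context: Let $N(n)=\{1,\dots,n\}$ and let $n$ be even. A (binary) frequency square of order $n$ is an $n\times n$ array indexed by $N(n)\times N(n)$ with entries in $\{0,1\}$ such that every row and every column contains exactly $n/2$ zeros and $n/2$ ones. Two frequency squares $F,G$ of order $n$ are orthogonal if for each $(a,b)\in\{0,1\}^2$ the number of cells $(r,c)$ with $(F[r,c],G[r,c])=(a,b)$ equals $n^2/4$. A $k$-MOFS$(n)$ is a set of $k$ pairwise orthogonal frequency squares of order $n$; it is maximal (a $k$-maxMOFS$(n)$) if there is no frequency square of order $n$ orthogonal to each of its members. -}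

module Defs where

open import Data.Nat using (ℕ; _+_; _*_)
open import Data.Nat.DivMod using (_/_)
open import Data.Bool using (Bool; true; false; if_then_else_)
open import Data.Fin using (Fin)
open import Data.List using (List; map; allFin)
open import Data.Nat.ListAction using (sum)
open import Data.Product using (_×_)
open import Relation.Binary.PropositionalEquality using (_≡_; _≢_)
open import Relation.Nullary using (¬_)
open import Data.Product using (Σ)

-- A binary array of order n, rows/columns indexed by Fin n (i.e. N(n)), entries 0 = false, 1 = true.
Array : ℕ → Set
Array n = Fin n → Fin n → Bool

count : (n : ℕ) → (Fin n → Bool) → ℕ
count n p = sum (map (λ i → if p i then 1 else 0) (allFin n))

_==_ : Bool → Bool → Bool
true  == true  = true
false == false = true
_     == _     = false

IsFrequencySquare : (n : ℕ) → Array n → Set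
IsFrequencySquare n F =
  ((r : Fin n) → count n (λ c → F r c) ≡ n / 2) ×
  ((c : Fin n) → count n (λ r → F r c) ≡ n / 2) ×
  ((r : Fin n) → count n (λ c → F r c == false) ≡ n / 2) ×
  ((c : Fin n) → count n (λ r → F r c == false) ≡ n / 2)

pairCount : (n : ℕ) → Array n → Array n → Bool → Bool → ℕ
pairCount n F G a b =
  sum (map (λ r → count n (λ c → if F r c == a then G r c == b else false)) (allFin n))

Orthogonal : (n : ℕ) → Array n → Array n → Set
Orthogonal n F G = (a b : Bool) → pairCount n F G a b ≡ (n * n) / 4

IsMOFS : (n k : ℕ) → (Fin k → Array n) → Set
IsMOFS n k S =
  ((i : Fin k) → IsFrequencySquare n (S i)) ×
  ((i j : Fin k) → i ≢ j → Orthogonal n (S i) (S j))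

IsMaxMOFS : (n k : ℕ) → (Fin k → Array n) → Set
IsMaxMOFS n k S =
  IsMOFS n k S ×
  ¬ (Σ (Array n) λ G → IsFrequencySquare n G × ((i : Fin k) → Orthogonal n (S i) G))

-- Five 10 × 10 patterns are inflated to order n = 6 + 4j by using pattern rows and columns
-- 0–5 once and repeating rows and columns 6–9 j times each, so every count in the inflated
-- squares is a polynomial in j whose coefficients are checked on the patterns by computation.
-- The fifth pattern is the xor of the other four with a row marker α and a column marker β.
-- The seven arrays (five squares and two inflated markers) therefore xor to zero in every
-- cell, so the total number of ones they share with any array G is even. If G were a
-- frequency square orthogonal to all five squares, this total would be
-- 5 (n/2)² + (|α| + |β|) n/2, which is odd because n/2 is odd and |α| + |β| = 4 + 4j.
module Submission where

open import Defs
open import Data.Nat using (ℕ; _≤_; _%_)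
open import Data.Fin using (Fin)
open import Data.Product using (Σ)
open import Relation.Binary.PropositionalEquality using (_≡_)

open import Data.Bool using (Bool; true; false; _∧_; _xor_; if_then_else_) renaming (_≟_ to _≟ᵇ_)
open import Data.Bool.Properties using (∧-distribʳ-xor)
open import Data.Fin.Patterns using (0F; 1F; 2F; 3F; 4F)
open import Data.Fin using (toℕ; #_) renaming (_≟_ to _≟ᶠ_)
open import Data.Fin.Properties using (all?)
open import Data.List using (List; []; _∷_; map; allFin; foldr; tabulate)
open import Data.List.Properties using (map-cong; map-tabulate)
open import Data.Nat using (zero; suc; _+_; _*_; _/_; _∸_; _≡ᵇ_; _≟_)
open import Data.Nat.DivMod using (m*n/n≡m)
open import Data.Nat.ListAction using (sum)
open import Data.Nat.Properties using (m+[n∸m]≡n; *-comm; *-zeroʳ; *-distribˡ-+; +-assoc; +-identityʳ)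
open import Data.Nat.Tactic.RingSolver using (solve-∀)
open import Data.Parity as ℙ using (0ℙ; 1ℙ)
open import Data.Parity.Properties using (+-homo-+; *-homo-*; p≢p⁻¹)
open import Data.Nat.Base using (parity)
open import Data.Product using (_,_; _×_; ∃-syntax)
open import Data.Vec using (Vec; lookup; []; _∷_)
open import Function using (_∘_)
open import Relation.Binary.PropositionalEquality using (refl; sym; trans; cong; cong₂; subst; _≢_; module ≡-Reasoning)
open import Relation.Nullary using (¬_; Dec)
open import Relation.Nullary.Decidable using (toWitness; map′; ¬?; _×-dec_; _→-dec_)

bit : Bool → ℕ
bit b = if b then 1 else 0

bit-∧ : ∀ a b → bit (a ∧ b) ≡ bit a * bit b
bit-∧ true  b = sym (+-identityʳ (bit b))
bit-∧ false b = refl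

∑ᶠ : (n : ℕ) → (Fin n → ℕ) → ℕ
∑ᶠ n f = sum (map f (allFin n))

∑< : ℕ → (ℕ → ℕ) → ℕ
∑< zero    f = 0
∑< (suc m) f = f 0 + ∑< m (f ∘ suc)

sum-map-cong : ∀ {A : Set} {f g : A → ℕ} → (∀ x → f x ≡ g x) → ∀ xs → sum (map f xs) ≡ sum (map g xs)
sum-map-cong f≗g xs = cong sum (map-cong f≗g xs)

sum-map-+ : ∀ {A : Set} (f g : A → ℕ) xs → sum (map (λ x → f x + g x) xs) ≡ sum (map f xs) + sum (map g xs)
sum-map-+ f g []       = refl
sum-map-+ f g (x ∷ xs) = trans (cong (f x + g x +_) (sum-map-+ f g xs)) (+-+-swap (f x) (g x) _ _)
  where
  +-+-swap : ∀ a b c d → (a + b) + (c + d) ≡ (a + c) + (b + d)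
  +-+-swap = solve-∀

sum-map-*ˡ : ∀ {A : Set} c (f : A → ℕ) xs → sum (map (λ x → c * f x) xs) ≡ c * sum (map f xs)
sum-map-*ˡ c f []       = sym (*-zeroʳ c)
sum-map-*ˡ c f (x ∷ xs) = trans (cong (c * f x +_) (sum-map-*ˡ c f xs)) (sym (*-distribˡ-+ c (f x) _))

sum-map-swap : ∀ {A B : Set} (f : A → B → ℕ) xs ys →
  sum (map (λ x → sum (map (f x) ys)) xs) ≡ sum (map (λ y → sum (map (λ x → f x y) xs)) ys)
sum-map-swap f []       ys = sym (sum-map-zero ys)
  where
  sum-map-zero : ∀ {B : Set} (ys : List B) → sum (map (λ _ → 0) ys) ≡ 0
  sum-map-zero []       = refl
  sum-map-zero (_ ∷ ys) = sum-map-zero ys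
sum-map-swap f (x ∷ xs) ys =
  trans (cong (sum (map (f x) ys) +_) (sum-map-swap f xs ys))
        (sym (sum-map-+ (f x) (λ y → sum (map (λ x → f x y) xs)) ys))

∑ᶠ-toℕ : ∀ n (h : ℕ → ℕ) → ∑ᶠ n (h ∘ toℕ) ≡ ∑< n h
∑ᶠ-toℕ n h = trans (cong sum (map-tabulate {n = n} (λ i → i) (h ∘ toℕ))) (sum-tabulate n h)
  where
  sum-tabulate : ∀ n (h : ℕ → ℕ) → sum (tabulate {n = n} (h ∘ toℕ)) ≡ ∑< n h
  sum-tabulate zero    h = refl
  sum-tabulate (suc n) h = cong (h 0 +_) (sum-tabulate n (h ∘ suc))

∑<-cong : ∀ m {f g : ℕ → ℕ} → (∀ k → f k ≡ g k) → ∑< m f ≡ ∑< m g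
∑<-cong zero    f≗g = refl
∑<-cong (suc m) f≗g = cong₂ _+_ (f≗g 0) (∑<-cong m (f≗g ∘ suc))

∑<-split : ∀ m k (f : ℕ → ℕ) → ∑< (m + k) f ≡ ∑< m f + ∑< k (f ∘ (m +_))
∑<-split zero    k f = refl
∑<-split (suc m) k f = trans (cong (f 0 +_) (∑<-split m k (f ∘ suc))) (sym (+-assoc (f 0) _ _))

∑<-periodic : ∀ j p (f : ℕ → ℕ) → (∀ k → f (p + k) ≡ f k) → ∑< (j * p) f ≡ j * ∑< p f
∑<-periodic zero    p f per = refl
∑<-periodic (suc j) p f per =
  trans (∑<-split p (j * p) f)
        (cong (∑< p f +_) (trans (∑<-cong (j * p) per) (∑<-periodic j p f per)))

∑<-linear : ∀ m (f g : ℕ → ℕ) c → ∑< m (λ k → f k + c * g k) ≡ ∑< m f + c * ∑< m g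
∑<-linear zero    f g c = sym (*-zeroʳ c)
∑<-linear (suc m) f g c =
  trans (cong (f 0 + c * g 0 +_) (∑<-linear m (f ∘ suc) (g ∘ suc) c))
        (regroup (f 0) (g 0) _ _ c)
  where
  regroup : ∀ a b d e c → (a + c * b) + (d + c * e) ≡ (a + d) + c * (b + e)
  regroup = solve-∀

Pattern : Set
Pattern = Fin 10 → Fin 10 → Bool

transpose complement : Pattern → Pattern
transpose φ x y = φ y x
complement φ x y = φ x y == false

periodicClass : ℕ → Fin 10
periodicClass 0 = # 6
periodicClass 1 = # 7
periodicClass 2 = # 8
periodicClass 3 = # 9
periodicClass (suc (suc (suc (suc k)))) = periodicClass k

classOf : ℕ → Fin 10
classOf 0 = # 0
classOf 1 = # 1
classOf 2 = # 2
classOf 3 = # 3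
classOf 4 = # 4
classOf 5 = # 5
classOf (suc (suc (suc (suc (suc (suc k)))))) = periodicClass k

inflate : ∀ {n} → Pattern → Array n
inflate φ r c = φ (classOf (toℕ r)) (classOf (toℕ c))

coreSum periodSum : (Fin 10 → ℕ) → ℕ
coreSum f = ∑< 6 (f ∘ classOf)
periodSum f = ∑< 4 (f ∘ periodicClass)

∑ᶠ-classOf : ∀ j (f : Fin 10 → ℕ) → ∑ᶠ (6 + j * 4) (f ∘ classOf ∘ toℕ) ≡ coreSum f + j * periodSum f
∑ᶠ-classOf j f = begin
  ∑ᶠ (6 + j * 4) (f ∘ classOf ∘ toℕ)             ≡⟨ ∑ᶠ-toℕ (6 + j * 4) (f ∘ classOf) ⟩
  ∑< (6 + j * 4) (f ∘ classOf)                   ≡⟨ ∑<-split 6 (j * 4) (f ∘ classOf) ⟩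
  coreSum f + ∑< (j * 4) (f ∘ periodicClass)      ≡⟨ cong (coreSum f +_) (∑<-periodic j 4 _ (λ _ → refl)) ⟩
  coreSum f + j * periodSum f                     ∎
  where open ≡-Reasoning

RowBalanced : Pattern → Set
RowBalanced φ = ∀ x → coreSum (bit ∘ φ x) ≡ 3 × periodSum (bit ∘ φ x) ≡ 2

rowBalanced? : ∀ φ → Dec (RowBalanced φ)
rowBalanced? φ = all? λ x → (coreSum (bit ∘ φ x) ≟ 3) ×-dec (periodSum (bit ∘ φ x) ≟ 2)

IsFrequencyPattern : Pattern → Set
IsFrequencyPattern φ =
  RowBalanced φ × RowBalanced (transpose φ) × RowBalanced (complement φ) × RowBalanced (complement (transpose φ))

isFrequencyPattern? : ∀ φ → Dec (IsFrequencyPattern φ)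
isFrequencyPattern? φ =
  rowBalanced? φ ×-dec rowBalanced? (transpose φ) ×-dec rowBalanced? (complement φ) ×-dec
  rowBalanced? (complement (transpose φ))

[6+4j]/2≡3+2j : ∀ j → (6 + j * 4) / 2 ≡ 3 + j * 2
[6+4j]/2≡3+2j j = trans (cong (_/ 2) (double j)) (m*n/n≡m (3 + j * 2) 2)
  where
  double : ∀ j → 6 + j * 4 ≡ (3 + j * 2) * 2
  double = solve-∀

[6+4j]²/4≡[3+2j]² : ∀ j → ((6 + j * 4) * (6 + j * 4)) / 4 ≡ (3 + j * 2) * (3 + j * 2)
[6+4j]²/4≡[3+2j]² j = trans (cong (_/ 4) (quadruple j)) (m*n/n≡m ((3 + j * 2) * (3 + j * 2)) 4)
  where
  quadruple : ∀ j → (6 + j * 4) * (6 + j * 4) ≡ (3 + j * 2) * (3 + j * 2) * 4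
  quadruple = solve-∀

inflate-rowCount : ∀ j φ → RowBalanced φ → ∀ r → count (6 + j * 4) (inflate φ r) ≡ (6 + j * 4) / 2
inflate-rowCount j φ balanced r with balanced (classOf (toℕ r))
... | core≡3 , period≡2 = begin
  ∑ᶠ (6 + j * 4) (bit ∘ φ x ∘ classOf ∘ toℕ)   ≡⟨ ∑ᶠ-classOf j (bit ∘ φ x) ⟩
  coreSum (bit ∘ φ x) + j * periodSum (bit ∘ φ x) ≡⟨ cong₂ (λ a b → a + j * b) core≡3 period≡2 ⟩
  3 + j * 2                                      ≡⟨ sym ([6+4j]/2≡3+2j j) ⟩
  (6 + j * 4) / 2                                ∎
  where
  open ≡-Reasoning
  x = classOf (toℕ r)

inflate-isFrequencySquare : ∀ j φ → IsFrequencyPattern φ → IsFrequencySquare (6 + j * 4) (inflate φ)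
inflate-isFrequencySquare j φ (rows , columns , rows₀ , columns₀) =
  inflate-rowCount j φ rows ,
  inflate-rowCount j (transpose φ) columns ,
  inflate-rowCount j (complement φ) rows₀ ,
  inflate-rowCount j (complement (transpose φ)) columns₀

coreBlock mixedBlocks periodBlock : (Fin 10 → Fin 10 → ℕ) → ℕ
coreBlock f = coreSum λ x → coreSum (f x)
mixedBlocks f = coreSum (λ x → periodSum (f x)) + periodSum (λ x → coreSum (f x))
periodBlock f = periodSum λ x → periodSum (f x)

∑ᶠ²-classOf : ∀ j (f : Fin 10 → Fin 10 → ℕ) →
  ∑ᶠ (6 + j * 4) (λ r → ∑ᶠ (6 + j * 4) (f (classOf (toℕ r)) ∘ classOf ∘ toℕ)) ≡
  coreBlock f + j * mixedBlocks f + j * j * periodBlock f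
∑ᶠ²-classOf j f = begin
  ∑ᶠ n (λ r → ∑ᶠ n (f (classOf (toℕ r)) ∘ classOf ∘ toℕ))
    ≡⟨ sum-map-cong (λ r → ∑ᶠ-classOf j (f (classOf (toℕ r)))) (allFin n) ⟩
  ∑ᶠ n (λ r → u (classOf (toℕ r)) + j * v (classOf (toℕ r)))
    ≡⟨ ∑ᶠ-classOf j (λ x → u x + j * v x) ⟩
  coreSum (λ x → u x + j * v x) + j * periodSum (λ x → u x + j * v x)
    ≡⟨ cong₂ (λ a b → a + j * b) (∑<-linear 6 (u ∘ classOf) (v ∘ classOf) j)
                                 (∑<-linear 4 (u ∘ periodicClass) (v ∘ periodicClass) j) ⟩
  (coreSum u + j * coreSum v) + j * (periodSum u + j * periodSum v)
    ≡⟨ regroup j (coreSum u) (coreSum v) (periodSum u) (periodSum v) ⟩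
  coreBlock f + j * mixedBlocks f + j * j * periodBlock f ∎
  where
  open ≡-Reasoning
  n = 6 + j * 4
  u v : Fin 10 → ℕ
  u x = coreSum (f x)
  v x = periodSum (f x)
  regroup : ∀ j a b c d → (a + j * b) + j * (c + j * d) ≡ a + j * (b + c) + j * j * d
  regroup = solve-∀

QuarterBlocks : (Fin 10 → Fin 10 → ℕ) → Set
QuarterBlocks f = coreBlock f ≡ 9 × mixedBlocks f ≡ 12 × periodBlock f ≡ 4

pairPattern : Pattern → Pattern → Bool → Bool → Fin 10 → Fin 10 → ℕ
pairPattern A B a b x y = bit (if A x y == a then B x y == b else false)

OrthogonalPatterns : Pattern → Pattern → Set
OrthogonalPatterns A B = ∀ a b → QuarterBlocks (pairPattern A B a b)

∀-Bool? : {P : Bool → Set} → (∀ b → Dec (P b)) → Dec (∀ b → P b)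
∀-Bool? P? = map′ (λ (pf , pt) → λ { false → pf ; true → pt }) (λ all → all false , all true) (P? false ×-dec P? true)

orthogonalPatterns? : ∀ A B → Dec (OrthogonalPatterns A B)
orthogonalPatterns? A B = ∀-Bool? λ a → ∀-Bool? λ b → let f = pairPattern A B a b in
  (coreBlock f ≟ 9) ×-dec (mixedBlocks f ≟ 12) ×-dec (periodBlock f ≟ 4)

inflate-orthogonal : ∀ j A B → OrthogonalPatterns A B → Orthogonal (6 + j * 4) (inflate A) (inflate B)
inflate-orthogonal j A B orthogonal a b with orthogonal a b
... | core≡9 , mixed≡12 , period≡4 = begin
  ∑ᶠ n (λ r → ∑ᶠ n (f (classOf (toℕ r)) ∘ classOf ∘ toℕ))
    ≡⟨ ∑ᶠ²-classOf j f ⟩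
  coreBlock f + j * mixedBlocks f + j * j * periodBlock f
    ≡⟨ cong₂ (λ s d → s + j * j * d) (cong₂ (λ a b → a + j * b) core≡9 mixed≡12) period≡4 ⟩
  9 + j * 12 + j * j * 4
    ≡⟨ expand j ⟩
  (3 + j * 2) * (3 + j * 2)
    ≡⟨ sym ([6+4j]²/4≡[3+2j]² j) ⟩
  (n * n) / 4 ∎
  where
  open ≡-Reasoning
  n = 6 + j * 4
  f = pairPattern A B a b
  expand : ∀ j → 9 + j * 12 + j * j * 4 ≡ (3 + j * 2) * (3 + j * 2)
  expand = solve-∀

Table : Set
Table = Vec (Vec ℕ 10) 10

fromTable : Table → Pattern
fromTable t x y = lookup (lookup t x) y ≡ᵇ 1

table₀ : Table
table₀ =
  (1 ∷ 0 ∷ 1 ∷ 0 ∷ 0 ∷ 1 ∷ 1 ∷ 0 ∷ 0 ∷ 1 ∷ []) ∷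
  (1 ∷ 0 ∷ 1 ∷ 1 ∷ 0 ∷ 0 ∷ 0 ∷ 0 ∷ 1 ∷ 1 ∷ []) ∷
  (0 ∷ 1 ∷ 1 ∷ 0 ∷ 1 ∷ 0 ∷ 1 ∷ 1 ∷ 0 ∷ 0 ∷ []) ∷
  (0 ∷ 1 ∷ 0 ∷ 1 ∷ 1 ∷ 0 ∷ 1 ∷ 1 ∷ 0 ∷ 0 ∷ []) ∷
  (0 ∷ 1 ∷ 0 ∷ 1 ∷ 0 ∷ 1 ∷ 0 ∷ 1 ∷ 1 ∷ 0 ∷ []) ∷
  (1 ∷ 0 ∷ 0 ∷ 0 ∷ 1 ∷ 1 ∷ 0 ∷ 0 ∷ 1 ∷ 1 ∷ []) ∷
  (0 ∷ 1 ∷ 0 ∷ 1 ∷ 0 ∷ 1 ∷ 0 ∷ 1 ∷ 0 ∷ 1 ∷ []) ∷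
  (1 ∷ 1 ∷ 0 ∷ 0 ∷ 1 ∷ 0 ∷ 1 ∷ 0 ∷ 1 ∷ 0 ∷ []) ∷
  (1 ∷ 0 ∷ 1 ∷ 0 ∷ 0 ∷ 1 ∷ 0 ∷ 1 ∷ 0 ∷ 1 ∷ []) ∷
  (0 ∷ 0 ∷ 1 ∷ 1 ∷ 1 ∷ 0 ∷ 1 ∷ 0 ∷ 1 ∷ 0 ∷ []) ∷ []

table₁ : Table
table₁ =
  (0 ∷ 1 ∷ 1 ∷ 0 ∷ 1 ∷ 0 ∷ 1 ∷ 1 ∷ 0 ∷ 0 ∷ []) ∷
  (1 ∷ 0 ∷ 0 ∷ 1 ∷ 0 ∷ 1 ∷ 1 ∷ 0 ∷ 0 ∷ 1 ∷ []) ∷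
  (0 ∷ 0 ∷ 1 ∷ 1 ∷ 1 ∷ 0 ∷ 0 ∷ 1 ∷ 1 ∷ 0 ∷ []) ∷
  (0 ∷ 1 ∷ 1 ∷ 0 ∷ 0 ∷ 1 ∷ 0 ∷ 1 ∷ 0 ∷ 1 ∷ []) ∷
  (1 ∷ 1 ∷ 0 ∷ 0 ∷ 1 ∷ 0 ∷ 0 ∷ 0 ∷ 1 ∷ 1 ∷ []) ∷
  (1 ∷ 0 ∷ 0 ∷ 1 ∷ 0 ∷ 1 ∷ 1 ∷ 0 ∷ 1 ∷ 0 ∷ []) ∷
  (1 ∷ 1 ∷ 1 ∷ 0 ∷ 0 ∷ 0 ∷ 0 ∷ 0 ∷ 1 ∷ 1 ∷ []) ∷
  (0 ∷ 1 ∷ 0 ∷ 1 ∷ 0 ∷ 1 ∷ 1 ∷ 1 ∷ 0 ∷ 0 ∷ []) ∷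
  (1 ∷ 0 ∷ 1 ∷ 0 ∷ 1 ∷ 0 ∷ 0 ∷ 0 ∷ 1 ∷ 1 ∷ []) ∷
  (0 ∷ 0 ∷ 0 ∷ 1 ∷ 1 ∷ 1 ∷ 1 ∷ 1 ∷ 0 ∷ 0 ∷ []) ∷ []

table₂ : Table
table₂ =
  (1 ∷ 1 ∷ 1 ∷ 0 ∷ 0 ∷ 0 ∷ 1 ∷ 0 ∷ 1 ∷ 0 ∷ []) ∷
  (0 ∷ 1 ∷ 1 ∷ 0 ∷ 1 ∷ 0 ∷ 1 ∷ 0 ∷ 1 ∷ 0 ∷ []) ∷
  (0 ∷ 0 ∷ 0 ∷ 1 ∷ 1 ∷ 1 ∷ 0 ∷ 1 ∷ 0 ∷ 1 ∷ []) ∷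
  (0 ∷ 1 ∷ 0 ∷ 1 ∷ 0 ∷ 1 ∷ 1 ∷ 0 ∷ 0 ∷ 1 ∷ []) ∷
  (1 ∷ 0 ∷ 1 ∷ 0 ∷ 0 ∷ 1 ∷ 0 ∷ 1 ∷ 0 ∷ 1 ∷ []) ∷
  (1 ∷ 0 ∷ 0 ∷ 1 ∷ 1 ∷ 0 ∷ 0 ∷ 1 ∷ 1 ∷ 0 ∷ []) ∷
  (1 ∷ 0 ∷ 1 ∷ 1 ∷ 0 ∷ 0 ∷ 0 ∷ 0 ∷ 1 ∷ 1 ∷ []) ∷
  (0 ∷ 0 ∷ 1 ∷ 0 ∷ 1 ∷ 1 ∷ 0 ∷ 0 ∷ 1 ∷ 1 ∷ []) ∷
  (1 ∷ 1 ∷ 0 ∷ 0 ∷ 0 ∷ 1 ∷ 1 ∷ 1 ∷ 0 ∷ 0 ∷ []) ∷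
  (0 ∷ 1 ∷ 0 ∷ 1 ∷ 1 ∷ 0 ∷ 1 ∷ 1 ∷ 0 ∷ 0 ∷ []) ∷ []

table₃ : Table
table₃ =
  (0 ∷ 0 ∷ 1 ∷ 0 ∷ 1 ∷ 1 ∷ 1 ∷ 0 ∷ 0 ∷ 1 ∷ []) ∷
  (0 ∷ 1 ∷ 0 ∷ 0 ∷ 1 ∷ 1 ∷ 0 ∷ 1 ∷ 1 ∷ 0 ∷ []) ∷
  (1 ∷ 0 ∷ 0 ∷ 1 ∷ 1 ∷ 0 ∷ 0 ∷ 1 ∷ 0 ∷ 1 ∷ []) ∷
  (1 ∷ 1 ∷ 0 ∷ 1 ∷ 0 ∷ 0 ∷ 0 ∷ 1 ∷ 1 ∷ 0 ∷ []) ∷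
  (0 ∷ 1 ∷ 1 ∷ 1 ∷ 0 ∷ 0 ∷ 1 ∷ 0 ∷ 0 ∷ 1 ∷ []) ∷
  (1 ∷ 0 ∷ 1 ∷ 0 ∷ 0 ∷ 1 ∷ 1 ∷ 0 ∷ 1 ∷ 0 ∷ []) ∷
  (1 ∷ 1 ∷ 0 ∷ 1 ∷ 0 ∷ 0 ∷ 0 ∷ 1 ∷ 0 ∷ 1 ∷ []) ∷
  (1 ∷ 0 ∷ 1 ∷ 1 ∷ 0 ∷ 0 ∷ 1 ∷ 0 ∷ 1 ∷ 0 ∷ []) ∷
  (0 ∷ 1 ∷ 0 ∷ 0 ∷ 1 ∷ 1 ∷ 1 ∷ 0 ∷ 1 ∷ 0 ∷ []) ∷
  (0 ∷ 0 ∷ 1 ∷ 0 ∷ 1 ∷ 1 ∷ 0 ∷ 1 ∷ 0 ∷ 1 ∷ []) ∷ []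

α β : Fin 10 → Bool
α x = lookup (1 ∷ 0 ∷ 0 ∷ 0 ∷ 0 ∷ 0 ∷ 1 ∷ 1 ∷ 0 ∷ 0 ∷ []) x ≡ᵇ 1
β y = lookup (1 ∷ 1 ∷ 1 ∷ 0 ∷ 0 ∷ 0 ∷ 1 ∷ 1 ∷ 0 ∷ 0 ∷ []) y ≡ᵇ 1

square : Fin 5 → Pattern
square 0F = fromTable table₀
square 1F = fromTable table₁
square 2F = fromTable table₂
square 3F = fromTable table₃
square 4F x y = square 0F x y xor square 1F x y xor square 2F x y xor square 3F x y xor α x xor β y

squares-frequency : ∀ i → IsFrequencyPattern (square i)
squares-frequency = toWitness {a? = all? (isFrequencyPattern? ∘ square)} _

squares-orthogonal : ∀ i k → i ≢ k → OrthogonalPatterns (square i) (square k)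
squares-orthogonal = toWitness {a? = all? λ i → all? λ k → ¬? (i ≟ᶠ k) →-dec orthogonalPatterns? (square i) (square k)} _

commonOnes : ∀ n → Array n → Array n → ℕ
commonOnes n F G = ∑ᶠ n λ r → ∑ᶠ n λ c → bit (F r c ∧ G r c)

pairCount-true-true : ∀ n F G → pairCount n F G true true ≡ commonOnes n F G
pairCount-true-true n F G =
  sum-map-cong (λ r → sum-map-cong (λ c → cong bit (both-true (F r c) (G r c))) (allFin n)) (allFin n)
  where
  both-true : ∀ x y → (if x == true then y == true else false) ≡ x ∧ y
  both-true true  true  = refl
  both-true true  false = refl
  both-true false y     = refl

rowMarker columnMarker : ∀ {n} → (Fin n → Bool) → Array n
rowMarker ρ r c = ρ r
columnMarker κ r c = κ c

commonOnes-rowMarker : ∀ n ρ G {h} → (∀ r → count n (G r) ≡ h) → commonOnes n (rowMarker ρ) G ≡ count n ρ * h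
commonOnes-rowMarker n ρ G {h} rows = begin
  ∑ᶠ n (λ r → ∑ᶠ n λ c → bit (ρ r ∧ G r c)) ≡⟨ sum-map-cong row (allFin n) ⟩
  ∑ᶠ n (λ r → h * bit (ρ r))                ≡⟨ sum-map-*ˡ h (bit ∘ ρ) (allFin n) ⟩
  h * count n ρ                              ≡⟨ *-comm h _ ⟩
  count n ρ * h                              ∎
  where
  open ≡-Reasoning
  row : ∀ r → ∑ᶠ n (λ c → bit (ρ r ∧ G r c)) ≡ h * bit (ρ r)
  row r = begin
    ∑ᶠ n (λ c → bit (ρ r ∧ G r c))     ≡⟨ sum-map-cong (λ c → bit-∧ (ρ r) (G r c)) (allFin n) ⟩
    ∑ᶠ n (λ c → bit (ρ r) * bit (G r c)) ≡⟨ sum-map-*ˡ (bit (ρ r)) (bit ∘ G r) (allFin n) ⟩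
    bit (ρ r) * count n (G r)            ≡⟨ cong (bit (ρ r) *_) (rows r) ⟩
    bit (ρ r) * h                        ≡⟨ *-comm (bit (ρ r)) h ⟩
    h * bit (ρ r)                        ∎

commonOnes-columnMarker : ∀ n κ G {h} → (∀ c → count n (λ r → G r c) ≡ h) → commonOnes n (columnMarker κ) G ≡ count n κ * h
commonOnes-columnMarker n κ G columns =
  trans (sum-map-swap (λ r c → bit (κ c ∧ G r c)) (allFin n) (allFin n))
        (commonOnes-rowMarker n κ (λ c r → G r c) columns)

xors : List Bool → Bool
xors = foldr _xor_ false

xors-map-∧ʳ : ∀ {A : Set} (p : A → Bool) g xs → xors (map (λ x → p x ∧ g) xs) ≡ xors (map p xs) ∧ g
xors-map-∧ʳ p g []       = refl
xors-map-∧ʳ p g (x ∷ xs) =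
  trans (cong (p x ∧ g xor_) (xors-map-∧ʳ p g xs)) (sym (∧-distribʳ-xor g (p x) _))

parity-sum-bits : ∀ {A : Set} (p : A → Bool) xs → parity (sum (map (bit ∘ p) xs)) ≡ parity (bit (xors (map p xs)))
parity-sum-bits p []       = refl
parity-sum-bits p (x ∷ xs) =
  trans (+-homo-+ (bit (p x)) _)
        (trans (cong (parity (bit (p x)) ℙ.+_) (parity-sum-bits p xs)) (parity-bit-xor (p x) _))
  where
  parity-bit-xor : ∀ a b → parity (bit a) ℙ.+ parity (bit b) ≡ parity (bit (a xor b))
  parity-bit-xor true  true  = refl
  parity-bit-xor true  false = refl
  parity-bit-xor false b     = refl

parity-sum-even : ∀ {A : Set} (f : A → ℕ) xs → (∀ x → parity (f x) ≡ 0ℙ) → parity (sum (map f xs)) ≡ 0ℙ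
parity-sum-even f []       even = refl
parity-sum-even f (x ∷ xs) even =
  trans (+-homo-+ (f x) _) (cong₂ ℙ._+_ (even x) (parity-sum-even f xs even))

parity-odd : ∀ m → parity (1 + 2 * m) ≡ 1ℙ
parity-odd m = trans (+-homo-+ 1 (2 * m)) (cong (1ℙ ℙ.+_) (*-homo-* 2 m))

sum-commonOnes-even : ∀ n (Fs : List (Array n)) G → (∀ r c → xors (map (λ F → F r c) Fs) ≡ false) →
  parity (sum (map (λ F → commonOnes n F G) Fs)) ≡ 0ℙ
sum-commonOnes-even n Fs G xor≡0 = begin
  parity (sum (map (λ F → commonOnes n F G) Fs))
    ≡⟨ cong parity (sum-map-swap (λ F r → ∑ᶠ n λ c → layer F r c) Fs (allFin n)) ⟩
  parity (∑ᶠ n λ r → sum (map (λ F → ∑ᶠ n (layer F r)) Fs))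
    ≡⟨ cong parity (sum-map-cong (λ r → sum-map-swap (λ F → layer F r) Fs (allFin n)) (allFin n)) ⟩
  parity (∑ᶠ n λ r → ∑ᶠ n λ c → sum (map (λ F → layer F r c) Fs))
    ≡⟨ parity-sum-even _ (allFin n) (λ r → parity-sum-even _ (allFin n) (cell-even r)) ⟩
  0ℙ ∎
  where
  open ≡-Reasoning
  layer : Array n → Fin n → Fin n → ℕ
  layer F r c = bit (F r c ∧ G r c)
  cell-even : ∀ r c → parity (sum (map (λ F → layer F r c) Fs)) ≡ 0ℙ
  cell-even r c = begin
    parity (sum (map (λ F → layer F r c) Fs))                 ≡⟨ parity-sum-bits (λ F → F r c ∧ G r c) Fs ⟩
    parity (bit (xors (map (λ F → F r c ∧ G r c) Fs)))         ≡⟨ cong (parity ∘ bit) (xors-map-∧ʳ (λ F → F r c) (G r c) Fs) ⟩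
    parity (bit (xors (map (λ F → F r c) Fs) ∧ G r c))         ≡⟨ cong (λ b → parity (bit (b ∧ G r c))) (xor≡0 r c) ⟩
    0ℙ                                                         ∎

layerPatterns : List Pattern
layerPatterns = square 0F ∷ square 1F ∷ square 2F ∷ square 3F ∷ square 4F ∷ (λ x _ → α x) ∷ (λ _ y → β y) ∷ []

layerPatterns-xor : ∀ x y → xors (map (λ φ → φ x y) layerPatterns) ≡ false
layerPatterns-xor = toWitness {a? = all? λ x → all? λ y → xors (map (λ φ → φ x y) layerPatterns) ≟ᵇ false} _

inflatedSquares : ∀ {n} → Fin 5 → Array n
inflatedSquares = inflate ∘ square

inflatedSquares-isMOFS : ∀ j → IsMOFS (6 + j * 4) 5 inflatedSquares
inflatedSquares-isMOFS j =
  (λ i → inflate-isFrequencySquare j (square i) (squares-frequency i)) ,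
  (λ i k i≢k → inflate-orthogonal j (square i) (square k) (squares-orthogonal i k i≢k))

layerCounts : ℕ → List ℕ
layerCounts j = h * h ∷ h * h ∷ h * h ∷ h * h ∷ h * h ∷ (1 + j * 2) * h ∷ (3 + j * 2) * h ∷ []
  where
  h = 3 + j * 2

commonOnes-layers : ∀ j G → IsFrequencySquare (6 + j * 4) G →
  ((i : Fin 5) → Orthogonal (6 + j * 4) (inflatedSquares i) G) →
  map (λ F → commonOnes (6 + j * 4) F G) (map inflate layerPatterns) ≡ layerCounts j
commonOnes-layers j G (rows , columns , _) orthogonal =
  cong₂ _∷_ (squareᵢ 0F) (cong₂ _∷_ (squareᵢ 1F) (cong₂ _∷_ (squareᵢ 2F) (cong₂ _∷_ (squareᵢ 3F)
  (cong₂ _∷_ (squareᵢ 4F) (cong₂ _∷_ marker-α (cong₂ _∷_ marker-β refl))))))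
  where
  n = 6 + j * 4
  h = 3 + j * 2
  squareᵢ : ∀ i → commonOnes n (inflatedSquares i) G ≡ h * h
  squareᵢ i = trans (sym (pairCount-true-true n (inflatedSquares i) G))
                    (trans (orthogonal i true true) ([6+4j]²/4≡[3+2j]² j))
  marker-α : commonOnes n (rowMarker (α ∘ classOf ∘ toℕ)) G ≡ (1 + j * 2) * h
  marker-α = trans (commonOnes-rowMarker n (α ∘ classOf ∘ toℕ) G (λ r → trans (rows r) ([6+4j]/2≡3+2j j)))
                   (cong (_* h) (∑ᶠ-classOf j (bit ∘ α)))
  marker-β : commonOnes n (columnMarker (β ∘ classOf ∘ toℕ)) G ≡ (3 + j * 2) * h
  marker-β = trans (commonOnes-columnMarker n (β ∘ classOf ∘ toℕ) G (λ c → trans (columns c) ([6+4j]/2≡3+2j j)))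
                   (cong (_* h) (∑ᶠ-classOf j (bit ∘ β)))

sum-layerCounts-odd : ∀ j → parity (sum (layerCounts j)) ≡ 1ℙ
sum-layerCounts-odd j = trans (cong parity (sum≡ j)) (parity-odd (28 + j * 40 + j * j * 14))
  where
  sum≡ : ∀ j → let h = 3 + j * 2 in
    h * h + (h * h + (h * h + (h * h + (h * h + ((1 + j * 2) * h + ((3 + j * 2) * h + 0)))))) ≡
    1 + 2 * (28 + j * 40 + j * j * 14)
  sum≡ = solve-∀

inflatedSquares-maximal : ∀ j → ¬ (Σ (Array (6 + j * 4)) λ G →
  IsFrequencySquare (6 + j * 4) G × ((i : Fin 5) → Orthogonal (6 + j * 4) (inflatedSquares i) G))
inflatedSquares-maximal j (G , isFrequency , orthogonal) = p≢p⁻¹ 0ℙ (begin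
  0ℙ
    ≡⟨ sym (sum-commonOnes-even n layers G λ r c → layerPatterns-xor (classOf (toℕ r)) (classOf (toℕ c))) ⟩
  parity (sum (map (λ F → commonOnes n F G) layers))
    ≡⟨ cong (parity ∘ sum) (commonOnes-layers j G isFrequency orthogonal) ⟩
  parity (sum (layerCounts j))
    ≡⟨ sum-layerCounts-odd j ⟩
  1ℙ ∎)
  where
  open ≡-Reasoning
  n = 6 + j * 4
  layers = map inflate layerPatterns

[6+k]%4≡2⇒k≡4j : ∀ k → (6 + k) % 4 ≡ 2 → ∃[ j ] k ≡ j * 4
[6+k]%4≡2⇒k≡4j 0 _ = 0 , refl
[6+k]%4≡2⇒k≡4j 1 ()
[6+k]%4≡2⇒k≡4j 2 ()
[6+k]%4≡2⇒k≡4j 3 ()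
[6+k]%4≡2⇒k≡4j (suc (suc (suc (suc k)))) eq with [6+k]%4≡2⇒k≡4j k eq
... | j , k≡4j = suc j , cong (4 +_) k≡4j

n%4≡2⇒n≡6+4j : ∀ n → 6 ≤ n → n % 4 ≡ 2 → ∃[ j ] n ≡ 6 + j * 4
n%4≡2⇒n≡6+4j n 6≤n n%4≡2 =
  let j , n∸6≡4j = [6+k]%4≡2⇒k≡4j (n ∸ 6) (subst (λ m → m % 4 ≡ 2) (sym 6+[n∸6]≡n) n%4≡2)
  in j , trans (sym 6+[n∸6]≡n) (cong (6 +_) n∸6≡4j)
  where
  6+[n∸6]≡n : 6 + (n ∸ 6) ≡ n
  6+[n∸6]≡n = m+[n∸m]≡n 6≤n

theorem7p1 : (n : ℕ) → 6 ≤ n → n % 4 ≡ 2 →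
    Σ (Fin 5 → Array n) λ S → IsMaxMOFS n 5 S
theorem7p1 n 6≤n n%4≡2 with n%4≡2⇒n≡6+4j n 6≤n n%4≡2
... | j , refl = inflatedSquares , inflatedSquares-isMOFS j , inflatedSquares-maximal j
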